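{- For all $n,N\in\mathbb{N}\cup\{0\}$, \[ A_{n+N}(t)=\sum_{i=1}^{N+1}a_{i-1}(N,t)\,(1-t)^{N+1-i}\,A_n^{(i)}(t), \] as an identity of polynomials in $t$ (equivalently, for all $t$).
   Context: The Eulerian polynomials $A_n(t)$ are defined by $\dfrac{1-t}{e^{x(t-1)}-t}=\sum_{n\ge 0}A_n(t)\dfrac{x^n}{n!}$. For a positive integer $m$, the higher-order Eulerian polynomials $A_n^{(m)}(t)$ are defined by $\left(\dfrac{1-t}{e^{x(t-1)}-t}\right)^{m}=\sum_{n\ge 0}A_n^{(m)}(t)\dfrac{x^n}{n!}$ (these are polynomials in $t$). The coefficients $a_i(N,t)$, for integers $N\ge 0$ and $0\le i\le N$, are defined by $a_0(N,t)=1$ for all $N\ge0$ and $a_i(N,t)=i\,t\sum_{j=0}^{N-i}(i+1)^{j}a_{i-1}(N-j-1,t)$ for $1\le i\le N$. -}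

module Defs where

open import Data.Nat as ℕ using (ℕ; zero; suc; _∸_)
open import Data.Nat.Combinatorics using (_C_)
open import Data.List using (List; []; _∷_)
open import Data.Integer using (ℤ; +_; _+_; _-_; _*_; -_; _^_; 0ℤ; 1ℤ)

Σ< : ℕ → (ℕ → ℤ) → ℤ
Σ< zero    f = 0ℤ
Σ< (suc n) f = Σ< n f + f n

-- Exponential power series in x with integer coefficients:
-- a series  Σ_n s n · x^n / n!  is represented by its EGF coefficients  s : ℕ → ℤ.
EGF : Set
EGF = ℕ → ℤ

_⊛_ : EGF → EGF → EGF
(a ⊛ b) n = Σ< (suc n) (λ k → + (n C k) * a k * b (n ∸ k))

one : EGF
one zero    = 1ℤ
one (suc _) = 0ℤ

_^ₛ_ : EGF → ℕ → EGF
s ^ₛ zero  = one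
s ^ₛ suc m = s ⊛ (s ^ₛ m)

-- Multiplicative inverse of a series with constant term 1:
-- h 0 = 1,  h n = - Σ_{k=1}^{n} C(n,k) g k h (n-k).
-- invList g n = [h n, h (n-1), ..., h 0]  (course-of-values recursion).
nth : List ℤ → ℕ → ℤ
nth []       _       = 0ℤ
nth (x ∷ xs) zero    = x
nth (x ∷ xs) (suc j) = nth xs j

invList : EGF → ℕ → List ℤ
invList g zero    = 1ℤ ∷ []
invList g (suc n) =
  (- Σ< (suc n) (λ j → + (suc n C suc j) * g (suc j) * nth (invList g n) j))
  ∷ invList g n

inv : EGF → EGF
inv g n = nth (invList g n) 0

-- For a fixed integer value t, the series
--   G(x) = (e^{x(t-1)} - t) / (1 - t) = 1 - Σ_{k≥1} (t-1)^{k-1} x^k / k!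
-- (a formal power series in x, valid for every t including t = 1),
-- in EGF coefficients: G 0 = 1, G k = -(t-1)^{k-1}.
Gser : ℤ → EGF
Gser t zero    = 1ℤ
Gser t (suc k) = - ((t - 1ℤ) ^ k)

-- (1-t)/(e^{x(t-1)}-t) = 1 / G(x)
eulerGF : ℤ → EGF
eulerGF t = inv (Gser t)

A : ℕ → ℤ → ℤ
A n t = eulerGF t n

Aʰ : ℕ → ℕ → ℤ → ℤ
Aʰ m n t = (eulerGF t ^ₛ m) n

a : ℕ → ℕ → ℤ → ℤ
a zero    N t = 1ℤ
a (suc i) N t =
  + suc i * t * Σ< (suc (N ∸ suc i)) (λ j → (+ suc (suc i)) ^ j * a i (N ∸ j ∸ 1) t)

-- Write F = (1-t)/(e^{x(t-1)}-t) = 1/G with G = (e^{x(t-1)}-t)/(1-t).  Since G' = (t-1)G - t,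
-- F satisfies the Riccati equation F' = tF² + (1-t)F, hence (F^m)' = mtF^{m+1} + m(1-t)F^m.
-- Induct on N: A_{n+N+1} is the n-th coefficient of the derivative of Σ_k c_k(N) F^{k+1}, where
-- c_k(N) = a_k(N,t)(1-t)^{N-k}.  Differentiating each power and collecting terms gives the
-- expansion for N+1, because the recursion defining a_i(N,t) makes the c_k obey
-- c_k(N+1) = (k+1)(1-t)c_k(N) + kt·c_{k-1}(N).
module Submission where

open import Data.Nat using (ℕ; zero; suc; _∸_; _<_; _≤_; s≤s) renaming (_+_ to _+ℕ_)
import Data.Nat.Properties as ℕ
open import Data.Nat.Combinatorics using (_C_; k>n⇒nCk≡0; nCk+nC[k+1]≡[n+1]C[k+1])
open import Data.Integer using (ℤ; +_; _+_; _-_; _*_; -_; _^_; 0ℤ; 1ℤ)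
import Data.Integer.Properties as ℤ
open import Data.Integer.Tactic.RingSolver using (solve-∀)
open import Algebra.Properties.AbelianGroup ℤ.+-0-abelianGroup using (inverseʳ-unique)
open import Function using (_∘_)
open import Relation.Binary.PropositionalEquality
open ≡-Reasoning

open import Defs

Σ<-cong : ∀ n {f g : ℕ → ℤ} → (∀ k → k < n → f k ≡ g k) → Σ< n f ≡ Σ< n g
Σ<-cong zero    f≡g = refl
Σ<-cong (suc n) f≡g =
  cong₂ _+_ (Σ<-cong n (λ k k<n → f≡g k (ℕ.m<n⇒m<1+n k<n))) (f≡g n (ℕ.n<1+n n))

Σ<-+ : ∀ n (f g : ℕ → ℤ) → Σ< n (λ k → f k + g k) ≡ Σ< n f + Σ< n g
Σ<-+ zero    f g = refl
Σ<-+ (suc n) f g = begin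
  Σ< n (λ k → f k + g k) + (f n + g n)  ≡⟨ cong (_+ (f n + g n)) (Σ<-+ n f g) ⟩
  Σ< n f + Σ< n g + (f n + g n)         ≡⟨ interchange (Σ< n f) (Σ< n g) (f n) (g n) ⟩
  Σ< n f + f n + (Σ< n g + g n)         ∎
  where
    interchange : ∀ a b c d → a + b + (c + d) ≡ a + c + (b + d)
    interchange = solve-∀

Σ<-*ˡ : ∀ n c (f : ℕ → ℤ) → Σ< n (λ k → c * f k) ≡ c * Σ< n f
Σ<-*ˡ zero    c f = sym (ℤ.*-zeroʳ c)
Σ<-*ˡ (suc n) c f = begin
  Σ< n (λ k → c * f k) + c * f n  ≡⟨ cong (_+ c * f n) (Σ<-*ˡ n c f) ⟩
  c * Σ< n f + c * f n            ≡⟨ ℤ.*-distribˡ-+ c (Σ< n f) (f n) ⟨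
  c * (Σ< n f + f n)              ∎

Σ<-head : ∀ n (f : ℕ → ℤ) → Σ< (suc n) f ≡ f 0 + Σ< n (f ∘ suc)
Σ<-head zero    f = ℤ.+-comm 0ℤ (f 0)
Σ<-head (suc n) f = begin
  Σ< (suc n) f + f (suc n)                ≡⟨ cong (_+ f (suc n)) (Σ<-head n f) ⟩
  f 0 + Σ< n (f ∘ suc) + f (suc n)        ≡⟨ ℤ.+-assoc (f 0) (Σ< n (f ∘ suc)) (f (suc n)) ⟩
  f 0 + (Σ< n (f ∘ suc) + f (suc n))      ∎

Σ<-zero : ∀ n (f : ℕ → ℤ) → (∀ k → f k ≡ 0ℤ) → Σ< n f ≡ 0ℤ
Σ<-zero zero    f f≡0 = refl
Σ<-zero (suc n) f f≡0 = cong₂ _+_ (Σ<-zero n f f≡0) (f≡0 n)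

Σ<-shift : ∀ N (x y q : ℕ → ℤ) →
  Σ< (suc N) (λ k → y k * q (suc k) + x k * q k)
    ≡ x 0 * q 0 + Σ< N (λ k → (x (suc k) + y k) * q (suc k)) + y N * q (suc N)
Σ<-shift zero    x y q = rearrange (x 0 * q 0) (y 0 * q 1)
  where
    rearrange : ∀ u v → 0ℤ + (v + u) ≡ u + 0ℤ + v
    rearrange = solve-∀
Σ<-shift (suc N) x y q = begin
  Σ< (suc N) _ + (y (suc N) * q (suc (suc N)) + x (suc N) * q (suc N))
    ≡⟨ cong (_+ (y (suc N) * q (suc (suc N)) + x (suc N) * q (suc N))) (Σ<-shift N x y q) ⟩
  x 0 * q 0 + S + y N * q (suc N) + (y (suc N) * q (suc (suc N)) + x (suc N) * q (suc N))
    ≡⟨ rearrange (x 0 * q 0) S (y N) (q (suc N)) (y (suc N) * q (suc (suc N))) (x (suc N)) ⟩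
  x 0 * q 0 + (S + (x (suc N) + y N) * q (suc N)) + y (suc N) * q (suc (suc N))
    ∎
  where
    S : ℤ
    S = Σ< N (λ k → (x (suc k) + y k) * q (suc k))
    rearrange : ∀ u s y' q' v x' → u + s + y' * q' + (v + x' * q') ≡ u + (s + (x' + y') * q') + v
    rearrange = solve-∀

infixl 6 _⊕_
infixr 7 _·_

_⊕_ : EGF → EGF → EGF
(f ⊕ g) n = f n + g n

_·_ : ℤ → EGF → EGF
(c · f) n = c * f n

-- d/dx acts on EGF coefficients as the shift.
D : EGF → EGF
D f n = f (suc n)

⊛-congˡ : ∀ {a a′} b → a ≗ a′ → a ⊛ b ≗ a′ ⊛ b
⊛-congˡ b a≗a′ n = Σ<-cong (suc n) (λ k _ → cong (λ u → + (n C k) * u * b (n ∸ k)) (a≗a′ k))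

⊛-congʳ : ∀ a {b b′} → b ≗ b′ → a ⊛ b ≗ a ⊛ b′
⊛-congʳ a b≗b′ n = Σ<-cong (suc n) (λ k _ → cong (+ (n C k) * a k *_) (b≗b′ (n ∸ k)))

⊛-distribʳ-⊕ : ∀ a b c → (a ⊕ b) ⊛ c ≗ a ⊛ c ⊕ b ⊛ c
⊛-distribʳ-⊕ a b c n = begin
  Σ< (suc n) (λ k → + (n C k) * (a k + b k) * c (n ∸ k))
    ≡⟨ Σ<-cong (suc n) (λ k _ → distrib (+ (n C k)) (a k) (b k) (c (n ∸ k))) ⟩
  Σ< (suc n) (λ k → + (n C k) * a k * c (n ∸ k) + + (n C k) * b k * c (n ∸ k))
    ≡⟨ Σ<-+ (suc n) _ _ ⟩
  (a ⊛ c) n + (b ⊛ c) n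
    ∎
  where
    distrib : ∀ w x y z → w * (x + y) * z ≡ w * x * z + w * y * z
    distrib = solve-∀

⊛-distribˡ-⊕ : ∀ a b c → a ⊛ (b ⊕ c) ≗ a ⊛ b ⊕ a ⊛ c
⊛-distribˡ-⊕ a b c n = begin
  Σ< (suc n) (λ k → + (n C k) * a k * (b (n ∸ k) + c (n ∸ k)))
    ≡⟨ Σ<-cong (suc n) (λ k _ → ℤ.*-distribˡ-+ (+ (n C k) * a k) (b (n ∸ k)) (c (n ∸ k))) ⟩
  Σ< (suc n) (λ k → + (n C k) * a k * b (n ∸ k) + + (n C k) * a k * c (n ∸ k))
    ≡⟨ Σ<-+ (suc n) _ _ ⟩
  (a ⊛ b) n + (a ⊛ c) n
    ∎

·-⊛ : ∀ s a b → (s · a) ⊛ b ≗ s · (a ⊛ b)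
·-⊛ s a b n = begin
  Σ< (suc n) (λ k → + (n C k) * (s * a k) * b (n ∸ k))
    ≡⟨ Σ<-cong (suc n) (λ k _ → pull (+ (n C k)) s (a k) (b (n ∸ k))) ⟩
  Σ< (suc n) (λ k → s * (+ (n C k) * a k * b (n ∸ k)))
    ≡⟨ Σ<-*ˡ (suc n) s _ ⟩
  s * (a ⊛ b) n
    ∎
  where
    pull : ∀ w s x y → w * (s * x) * y ≡ s * (w * x * y)
    pull = solve-∀

⊛-· : ∀ s a b → a ⊛ (s · b) ≗ s · (a ⊛ b)
⊛-· s a b n = begin
  Σ< (suc n) (λ k → + (n C k) * a k * (s * b (n ∸ k)))
    ≡⟨ Σ<-cong (suc n) (λ k _ → pull (+ (n C k)) s (a k) (b (n ∸ k))) ⟩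
  Σ< (suc n) (λ k → s * (+ (n C k) * a k * b (n ∸ k)))
    ≡⟨ Σ<-*ˡ (suc n) s _ ⟩
  s * (a ⊛ b) n
    ∎
  where
    pull : ∀ w s x y → w * x * (s * y) ≡ s * (w * x * y)
    pull = solve-∀

⊛-D-expand : ∀ a b n →
  (a ⊛ D b) n ≡ a 0 * b (suc n) + Σ< (suc n) (λ j → + (n C suc j) * a (suc j) * b (n ∸ j))
⊛-D-expand a b n = begin
  (a ⊛ D b) n
    ≡⟨ Σ<-head n _ ⟩
  + 1 * a 0 * b (suc n) + Σ< n (λ j → + (n C suc j) * a (suc j) * b (suc (n ∸ suc j)))
    ≡⟨ cong₂ _+_ (cong (_* b (suc n)) (ℤ.*-identityˡ (a 0)))
                 (Σ<-cong n (λ j j<n → cong (λ m → term j * b m) (sym (ℕ.+-∸-assoc 1 j<n)))) ⟩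
  a 0 * b (suc n) + Σ< n (λ j → term j * b (n ∸ j))
    ≡⟨ cong (_+_ (a 0 * b (suc n))) (ℤ.+-identityʳ _) ⟨
  a 0 * b (suc n) + (Σ< n (λ j → term j * b (n ∸ j)) + 0ℤ)
    ≡⟨ cong (λ m → a 0 * b (suc n) + (Σ< n (λ j → term j * b (n ∸ j)) + + m * a (suc n) * b (n ∸ n)))
            (k>n⇒nCk≡0 (ℕ.n<1+n n)) ⟨
  a 0 * b (suc n) + Σ< (suc n) (λ j → term j * b (n ∸ j))
    ∎
  where
    term : ℕ → ℤ
    term j = + (n C suc j) * a (suc j)

D-⊛ : ∀ a b → D (a ⊛ b) ≗ D a ⊛ b ⊕ a ⊛ D b
D-⊛ a b n = begin
  (a ⊛ b) (suc n)
    ≡⟨ Σ<-head (suc n) _ ⟩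
  + 1 * a 0 * b (suc n) + Σ< (suc n) (λ j → + (suc n C suc j) * a (suc j) * b (n ∸ j))
    ≡⟨ cong₂ _+_ (cong (_* b (suc n)) (ℤ.*-identityˡ (a 0))) (Σ<-cong (suc n) (λ j _ → pascal j)) ⟩
  a 0 * b (suc n) + Σ< (suc n) (λ j → + (n C j) * a (suc j) * b (n ∸ j)
                                      + + (n C suc j) * a (suc j) * b (n ∸ j))
    ≡⟨ cong (_+_ (a 0 * b (suc n))) (Σ<-+ (suc n) _ _) ⟩
  a 0 * b (suc n) + ((D a ⊛ b) n + R)
    ≡⟨ left-comm (a 0 * b (suc n)) ((D a ⊛ b) n) R ⟩
  (D a ⊛ b) n + (a 0 * b (suc n) + R)
    ≡⟨ cong (_+_ ((D a ⊛ b) n)) (⊛-D-expand a b n) ⟨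
  (D a ⊛ b) n + (a ⊛ D b) n
    ∎
  where
    R : ℤ
    R = Σ< (suc n) (λ j → + (n C suc j) * a (suc j) * b (n ∸ j))
    left-comm : ∀ x y z → x + (y + z) ≡ y + (x + z)
    left-comm = solve-∀
    pascal : ∀ j → + (suc n C suc j) * a (suc j) * b (n ∸ j)
                 ≡ + (n C j) * a (suc j) * b (n ∸ j) + + (n C suc j) * a (suc j) * b (n ∸ j)
    pascal j = begin
      + (suc n C suc j) * a (suc j) * b (n ∸ j)
        ≡⟨ cong (λ m → + m * a (suc j) * b (n ∸ j)) (nCk+nC[k+1]≡[n+1]C[k+1] n j) ⟨
      + (n C j +ℕ n C suc j) * a (suc j) * b (n ∸ j)
        ≡⟨ cong (λ m → m * a (suc j) * b (n ∸ j)) (ℤ.pos-+ (n C j) (n C suc j)) ⟩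
      (+ (n C j) + + (n C suc j)) * a (suc j) * b (n ∸ j)
        ≡⟨ distrib (+ (n C j)) (+ (n C suc j)) (a (suc j)) (b (n ∸ j)) ⟩
      + (n C j) * a (suc j) * b (n ∸ j) + + (n C suc j) * a (suc j) * b (n ∸ j)
        ∎
      where
        distrib : ∀ u v x y → (u + v) * x * y ≡ u * x * y + v * x * y
        distrib = solve-∀

⊛-comm : ∀ a b → a ⊛ b ≗ b ⊛ a
⊛-comm a b zero    = cong (_+_ 0ℤ) (swap (a 0) (b 0))
  where
    swap : ∀ x y → + 1 * x * y ≡ + 1 * y * x
    swap = solve-∀
⊛-comm a b (suc n) = begin
  (a ⊛ b) (suc n)                  ≡⟨ D-⊛ a b n ⟩
  (D a ⊛ b) n + (a ⊛ D b) n        ≡⟨ cong₂ _+_ (⊛-comm (D a) b n) (⊛-comm a (D b) n) ⟩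
  (b ⊛ D a) n + (D b ⊛ a) n        ≡⟨ ℤ.+-comm ((b ⊛ D a) n) ((D b ⊛ a) n) ⟩
  (D b ⊛ a) n + (b ⊛ D a) n        ≡⟨ D-⊛ b a n ⟨
  (b ⊛ a) (suc n)                  ∎

⊛-assoc : ∀ a b c → (a ⊛ b) ⊛ c ≗ a ⊛ (b ⊛ c)
⊛-assoc a b c zero    = cong (_+_ 0ℤ) (reassoc (a 0) (b 0) (c 0))
  where
    reassoc : ∀ x y z → + 1 * (0ℤ + + 1 * x * y) * z ≡ + 1 * x * (0ℤ + + 1 * y * z)
    reassoc = solve-∀
⊛-assoc a b c (suc n) = begin
  ((a ⊛ b) ⊛ c) (suc n)
    ≡⟨ D-⊛ (a ⊛ b) c n ⟩
  (D (a ⊛ b) ⊛ c) n + ((a ⊛ b) ⊛ D c) n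
    ≡⟨ cong (_+ ((a ⊛ b) ⊛ D c) n)
            (trans (⊛-congˡ c (D-⊛ a b) n) (⊛-distribʳ-⊕ (D a ⊛ b) (a ⊛ D b) c n)) ⟩
  ((D a ⊛ b) ⊛ c) n + ((a ⊛ D b) ⊛ c) n + ((a ⊛ b) ⊛ D c) n
    ≡⟨ cong₂ _+_ (cong₂ _+_ (⊛-assoc (D a) b c n) (⊛-assoc a (D b) c n)) (⊛-assoc a b (D c) n) ⟩
  (D a ⊛ (b ⊛ c)) n + (a ⊛ (D b ⊛ c)) n + (a ⊛ (b ⊛ D c)) n
    ≡⟨ ℤ.+-assoc ((D a ⊛ (b ⊛ c)) n) ((a ⊛ (D b ⊛ c)) n) ((a ⊛ (b ⊛ D c)) n) ⟩
  (D a ⊛ (b ⊛ c)) n + ((a ⊛ (D b ⊛ c)) n + (a ⊛ (b ⊛ D c)) n)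
    ≡⟨ cong (_+_ ((D a ⊛ (b ⊛ c)) n))
            (trans (⊛-congʳ a (D-⊛ b c) n) (⊛-distribˡ-⊕ a (D b ⊛ c) (b ⊛ D c) n)) ⟨
  (D a ⊛ (b ⊛ c)) n + (a ⊛ D (b ⊛ c)) n
    ≡⟨ D-⊛ a (b ⊛ c) n ⟨
  (a ⊛ (b ⊛ c)) (suc n)
    ∎

⊛-identityˡ : ∀ b → one ⊛ b ≗ b
⊛-identityˡ b n = begin
  (one ⊛ b) n
    ≡⟨ Σ<-head n _ ⟩
  + 1 * 1ℤ * b n + Σ< n (λ k → + (n C suc k) * 0ℤ * b (n ∸ suc k))
    ≡⟨ cong₂ _+_ (ℤ.*-identityˡ (b n))
                 (Σ<-zero n _ (λ k → cong (_* b (n ∸ suc k)) (ℤ.*-zeroʳ (+ (n C suc k))))) ⟩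
  b n + 0ℤ
    ≡⟨ ℤ.+-identityʳ (b n) ⟩
  b n
    ∎

⊛-identityʳ : ∀ b → b ⊛ one ≗ b
⊛-identityʳ b n = trans (⊛-comm b one n) (⊛-identityˡ b n)

nth-invList : ∀ g n j → j ≤ n → nth (invList g n) j ≡ inv g (n ∸ j)
nth-invList g n       zero    _         = refl
nth-invList g (suc n) (suc j) (s≤s j≤n) = nth-invList g n j j≤n

⊛-inverseʳ : ∀ g → g 0 ≡ 1ℤ → g ⊛ inv g ≗ one
⊛-inverseʳ g g0≡1 zero    = cong (λ x → 0ℤ + + 1 * x * 1ℤ) g0≡1
⊛-inverseʳ g g0≡1 (suc n) = begin
  (g ⊛ inv g) (suc n)
    ≡⟨ Σ<-head (suc n) _ ⟩
  + 1 * g 0 * inv g (suc n) + Σ< (suc n) (λ k → + (suc n C suc k) * g (suc k) * inv g (n ∸ k))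
    ≡⟨ cong₂ _+_ (cong (λ x → + 1 * x * inv g (suc n)) g0≡1)
                 (Σ<-cong (suc n) (λ k k<1+n → cong (+ (suc n C suc k) * g (suc k) *_)
                                                   (sym (nth-invList g n k (ℕ.≤-pred k<1+n))))) ⟩
  + 1 * 1ℤ * (- S) + S
    ≡⟨ cancel S ⟩
  0ℤ
    ∎
  where
    S : ℤ
    S = Σ< (suc n) (λ j → + (suc n C suc j) * g (suc j) * nth (invList g n) j)
    cancel : ∀ x → + 1 * 1ℤ * (- x) + x ≡ 0ℤ
    cancel = solve-∀

-- Differentiate g f = 1 to get g f' = -g' f, then multiply by f.
D-inv : ∀ g p q → g 0 ≡ 1ℤ → D g ≗ (- p) · one ⊕ (- q) · g →
        D (inv g) ≗ p · (inv g ⊛ inv g) ⊕ q · inv g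
D-inv g p q g0≡1 Dg n = begin
  D f n
    ≡⟨ ⊛-identityˡ (D f) n ⟨
  (one ⊛ D f) n
    ≡⟨ ⊛-congˡ (D f) f⊛g≗one n ⟨
  ((f ⊛ g) ⊛ D f) n
    ≡⟨ ⊛-assoc f g (D f) n ⟩
  (f ⊛ (g ⊛ D f)) n
    ≡⟨ ⊛-congʳ f g⊛Df n ⟩
  (f ⊛ (p · f ⊕ q · one)) n
    ≡⟨ ⊛-distribˡ-⊕ f (p · f) (q · one) n ⟩
  (f ⊛ (p · f)) n + (f ⊛ (q · one)) n
    ≡⟨ cong₂ _+_ (⊛-· p f f n) (trans (⊛-· q f one n) (cong (q *_) (⊛-identityʳ f n))) ⟩
  p * (f ⊛ f) n + q * f n
    ∎
  where
    f : EGF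
    f = inv g
    f⊛g≗one : f ⊛ g ≗ one
    f⊛g≗one m = trans (⊛-comm f g m) (⊛-inverseʳ g g0≡1 m)
    negate : ∀ p q x y → - (- p * x + - q * y) ≡ p * x + q * y
    negate = solve-∀
    g⊛Df : g ⊛ D f ≗ p · f ⊕ q · one
    g⊛Df m = begin
      (g ⊛ D f) m
        ≡⟨ inverseʳ-unique ((D g ⊛ f) m) ((g ⊛ D f) m)
             (trans (sym (D-⊛ g f m)) (⊛-inverseʳ g g0≡1 (suc m))) ⟩
      - (D g ⊛ f) m
        ≡⟨ cong -_ (⊛-congˡ f Dg m) ⟩
      - (((- p) · one ⊕ (- q) · g) ⊛ f) m
        ≡⟨ cong -_ (⊛-distribʳ-⊕ ((- p) · one) ((- q) · g) f m) ⟩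
      - ((((- p) · one) ⊛ f) m + (((- q) · g) ⊛ f) m)
        ≡⟨ cong -_ (cong₂ _+_ (·-⊛ (- p) one f m) (·-⊛ (- q) g f m)) ⟩
      - (- p * (one ⊛ f) m + - q * (g ⊛ f) m)
        ≡⟨ cong -_ (cong₂ (λ x y → - p * x + - q * y) (⊛-identityˡ f m) (⊛-inverseʳ g g0≡1 m)) ⟩
      - (- p * f m + - q * one m)
        ≡⟨ negate p q (f m) (one m) ⟩
      p * f m + q * one m
        ∎

D-^ₛ : ∀ f p q → D f ≗ p · (f ⊛ f) ⊕ q · f →
       ∀ m → D (f ^ₛ m) ≗ (+ m * p) · f ^ₛ suc m ⊕ (+ m * q) · f ^ₛ m
D-^ₛ f p q Df zero    n = refl
D-^ₛ f p q Df (suc m) n = begin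
  D (f ⊛ (f ^ₛ m)) n
    ≡⟨ D-⊛ f (f ^ₛ m) n ⟩
  (D f ⊛ (f ^ₛ m)) n + (f ⊛ D (f ^ₛ m)) n
    ≡⟨ cong₂ _+_ (trans (⊛-congˡ (f ^ₛ m) Df n) (⊛-distribʳ-⊕ (p · (f ⊛ f)) (q · f) (f ^ₛ m) n))
                 (trans (⊛-congʳ f (D-^ₛ f p q Df m) n)
                        (⊛-distribˡ-⊕ f ((+ m * p) · f ^ₛ suc m) ((+ m * q) · f ^ₛ m) n)) ⟩
  ((p · (f ⊛ f)) ⊛ (f ^ₛ m)) n + ((q · f) ⊛ (f ^ₛ m)) n
    + ((f ⊛ ((+ m * p) · f ^ₛ suc m)) n + (f ⊛ ((+ m * q) · f ^ₛ m)) n)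
    ≡⟨ cong₂ _+_ (cong₂ _+_ (trans (·-⊛ p (f ⊛ f) (f ^ₛ m) n) (cong (p *_) (⊛-assoc f f (f ^ₛ m) n)))
                            (·-⊛ q f (f ^ₛ m) n))
                 (cong₂ _+_ (⊛-· (+ m * p) f (f ^ₛ suc m) n) (⊛-· (+ m * q) f (f ^ₛ m) n)) ⟩
  p * F₂ + q * F₁ + (+ m * p * F₂ + + m * q * F₁)
    ≡⟨ collect (+ m) p q F₂ F₁ ⟩
  (1ℤ + + m) * p * F₂ + (1ℤ + + m) * q * F₁
    ∎
  where
    F₂ F₁ : ℤ
    F₂ = (f ^ₛ suc (suc m)) n
    F₁ = (f ^ₛ suc m) n
    collect : ∀ m p q x y → p * x + q * y + (m * p * x + m * q * y)
                          ≡ (1ℤ + m) * p * x + (1ℤ + m) * q * y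
    collect = solve-∀

D-Gser : ∀ t → D (Gser t) ≗ (- t) · one ⊕ (- (1ℤ - t)) · Gser t
D-Gser t zero    = at-zero t
  where
    at-zero : ∀ t → - 1ℤ ≡ - t * 1ℤ + - (1ℤ - t) * 1ℤ
    at-zero = solve-∀
D-Gser t (suc k) = at-suc t ((t - 1ℤ) ^ k)
  where
    at-suc : ∀ t x → - ((t - 1ℤ) * x) ≡ - t * 0ℤ + - (1ℤ - t) * - x
    at-suc = solve-∀

D-eulerGF : ∀ t → D (eulerGF t) ≗ t · (eulerGF t ⊛ eulerGF t) ⊕ (1ℤ - t) · eulerGF t
D-eulerGF t = D-inv (Gser t) t (1ℤ - t) refl (D-Gser t)

a-suc-suc : ∀ i N t → a (suc i) (suc N) t
  ≡ + suc i * t * (a i N t + + suc (suc i) * Σ< (N ∸ i) (λ j → (+ suc (suc i)) ^ j * a i (N ∸ j ∸ 1) t))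
a-suc-suc i N t = cong (λ s → + suc i * t * s) (begin
  Σ< (suc (N ∸ i)) (λ j → b ^ j * a i (suc N ∸ j ∸ 1) t)
    ≡⟨ Σ<-head (N ∸ i) _ ⟩
  1ℤ * a i N t + Σ< (N ∸ i) (λ j → b * b ^ j * a i (N ∸ j ∸ 1) t)
    ≡⟨ cong₂ _+_ (ℤ.*-identityˡ (a i N t))
                 (trans (Σ<-cong (N ∸ i) (λ j _ → ℤ.*-assoc b (b ^ j) (a i (N ∸ j ∸ 1) t)))
                        (Σ<-*ˡ (N ∸ i) b _)) ⟩
  a i N t + b * Σ< (N ∸ i) (λ j → b ^ j * a i (N ∸ j ∸ 1) t)
    ∎)
  where
    b : ℤ
    b = + suc (suc i)

a-suc-suc-< : ∀ {i N} t → i < N →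
  a (suc i) (suc N) t ≡ + suc i * t * a i N t + + suc (suc i) * a (suc i) N t
a-suc-suc-< {i} {N} t i<N = begin
  a (suc i) (suc N) t
    ≡⟨ a-suc-suc i N t ⟩
  + suc i * t * (a i N t + + suc (suc i) * Σ< (N ∸ i) f)
    ≡⟨ cong (λ m → + suc i * t * (a i N t + + suc (suc i) * Σ< m f)) (ℕ.+-∸-assoc 1 i<N) ⟩
  + suc i * t * (a i N t + + suc (suc i) * Σ< (suc (N ∸ suc i)) f)
    ≡⟨ distrib (+ suc i) t (a i N t) (+ suc (suc i)) (Σ< (suc (N ∸ suc i)) f) ⟩
  + suc i * t * a i N t + + suc (suc i) * a (suc i) N t
    ∎
  where
    f : ℕ → ℤ
    f j = (+ suc (suc i)) ^ j * a i (N ∸ j ∸ 1) t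
    distrib : ∀ c t x b s → c * t * (x + b * s) ≡ c * t * x + b * (c * t * s)
    distrib = solve-∀

a-diagonal : ∀ N t → a (suc N) (suc N) t ≡ + suc N * t * a N N t
a-diagonal N t = begin
  a (suc N) (suc N) t
    ≡⟨ a-suc-suc N N t ⟩
  + suc N * t * (a N N t + + suc (suc N) * Σ< (N ∸ N) f)
    ≡⟨ cong (λ m → + suc N * t * (a N N t + + suc (suc N) * Σ< m f)) (ℕ.n∸n≡0 N) ⟩
  + suc N * t * (a N N t + + suc (suc N) * 0ℤ)
    ≡⟨ drop (+ suc N) t (a N N t) (+ suc (suc N)) ⟩
  + suc N * t * a N N t
    ∎
  where
    f : ℕ → ℤ
    f j = (+ suc (suc N)) ^ j * a N (N ∸ j ∸ 1) t
    drop : ∀ c t x b → c * t * (x + b * 0ℤ) ≡ c * t * x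
    drop = solve-∀

coeff : ℤ → ℕ → ℕ → ℤ
coeff t N k = a k N t * (1ℤ - t) ^ (N ∸ k)

coeff-zero : ∀ t N → coeff t (suc N) 0 ≡ coeff t N 0 * (+ 1 * (1ℤ - t))
coeff-zero t N = shuffle t ((1ℤ - t) ^ N)
  where
    shuffle : ∀ t x → 1ℤ * ((1ℤ - t) * x) ≡ 1ℤ * x * (+ 1 * (1ℤ - t))
    shuffle = solve-∀

coeff-diagonal : ∀ t N → coeff t (suc N) (suc N) ≡ coeff t N N * (+ suc N * t)
coeff-diagonal t N = begin
  a (suc N) (suc N) t * (1ℤ - t) ^ (N ∸ N)
    ≡⟨ cong₂ (λ x m → x * (1ℤ - t) ^ m) (a-diagonal N t) (ℕ.n∸n≡0 N) ⟩
  + suc N * t * a N N t * 1ℤ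
    ≡⟨ shuffle (+ suc N) t (a N N t) ⟩
  a N N t * 1ℤ * (+ suc N * t)
    ≡⟨ cong (λ m → a N N t * (1ℤ - t) ^ m * (+ suc N * t)) (ℕ.n∸n≡0 N) ⟨
  coeff t N N * (+ suc N * t)
    ∎
  where
    shuffle : ∀ c t x → c * t * x * 1ℤ ≡ x * 1ℤ * (c * t)
    shuffle = solve-∀

coeff-suc : ∀ t {N j} → j < N →
  coeff t (suc N) (suc j) ≡ coeff t N (suc j) * (+ suc (suc j) * (1ℤ - t)) + coeff t N j * (+ suc j * t)
coeff-suc t {N} {j} j<N = begin
  a (suc j) (suc N) t * (1ℤ - t) ^ (N ∸ j)
    ≡⟨ cong₂ (λ x m → x * (1ℤ - t) ^ m) (a-suc-suc-< t j<N) (ℕ.+-∸-assoc 1 j<N) ⟩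
  (+ suc j * t * a j N t + + suc (suc j) * a (suc j) N t) * ((1ℤ - t) * e)
    ≡⟨ shuffle (+ suc j) (+ suc (suc j)) t (a j N t) (a (suc j) N t) e ⟩
  a (suc j) N t * e * (+ suc (suc j) * (1ℤ - t)) + a j N t * ((1ℤ - t) * e) * (+ suc j * t)
    ≡⟨ cong (λ m → coeff t N (suc j) * (+ suc (suc j) * (1ℤ - t)) + a j N t * (1ℤ - t) ^ m * (+ suc j * t))
            (ℕ.+-∸-assoc 1 j<N) ⟨
  coeff t N (suc j) * (+ suc (suc j) * (1ℤ - t)) + coeff t N j * (+ suc j * t)
    ∎
  where
    e : ℤ
    e = (1ℤ - t) ^ (N ∸ suc j)
    shuffle : ∀ c c′ t x x′ e → (c * t * x + c′ * x′) * ((1ℤ - t) * e)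
                              ≡ x′ * e * (c′ * (1ℤ - t)) + x * ((1ℤ - t) * e) * (c * t)
    shuffle = solve-∀

expansion-step : ∀ t N n →
  Σ< (suc N) (λ k → coeff t N k * Aʰ (suc k) (suc n) t)
    ≡ Σ< (suc (suc N)) (λ k → coeff t (suc N) k * Aʰ (suc k) n t)
expansion-step t N n = begin
  Σ< (suc N) (λ k → coeff t N k * D (eulerGF t ^ₛ suc k) n)
    ≡⟨ Σ<-cong (suc N) (λ k _ → differentiate k) ⟩
  Σ< (suc N) (λ k → y k * q (suc k) + x k * q k)
    ≡⟨ Σ<-shift N x y q ⟩
  x 0 * q 0 + Σ< N (λ k → (x (suc k) + y k) * q (suc k)) + y N * q (suc N)
    ≡⟨ cong₂ _+_ (cong₂ _+_ (cong (_* q 0) (coeff-zero t N))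
                            (Σ<-cong N (λ k k<N → cong (_* q (suc k)) (coeff-suc t k<N))))
                 (cong (_* q (suc N)) (coeff-diagonal t N)) ⟨
  coeff t (suc N) 0 * q 0 + Σ< N (λ k → coeff t (suc N) (suc k) * q (suc k))
    + coeff t (suc N) (suc N) * q (suc N)
    ≡⟨ cong (_+ coeff t (suc N) (suc N) * q (suc N)) (Σ<-head N (λ k → coeff t (suc N) k * q k)) ⟨
  Σ< (suc (suc N)) (λ k → coeff t (suc N) k * q k)
    ∎
  where
    q x y : ℕ → ℤ
    q k = Aʰ (suc k) n t
    x k = coeff t N k * (+ suc k * (1ℤ - t))
    y k = coeff t N k * (+ suc k * t)
    expand : ∀ c u v Q₁ Q₀ → c * (u * Q₁ + v * Q₀) ≡ c * u * Q₁ + c * v * Q₀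
    expand = solve-∀
    differentiate : ∀ k → coeff t N k * D (eulerGF t ^ₛ suc k) n ≡ y k * q (suc k) + x k * q k
    differentiate k = trans (cong (coeff t N k *_) (D-^ₛ (eulerGF t) t (1ℤ - t) (D-eulerGF t) (suc k) n))
                            (expand (coeff t N k) (+ suc k * t) (+ suc k * (1ℤ - t)) (q (suc k)) (q k))

theorem2 : (n N : ℕ) (t : ℤ) →
    A (n +ℕ N) t ≡
      Σ< (suc N) (λ k → a k N t * (1ℤ - t) ^ (N ∸ k) * Aʰ (suc k) n t)
theorem2 n zero t = begin
  A (n +ℕ 0) t                  ≡⟨ cong (λ m → A m t) (ℕ.+-identityʳ n) ⟩
  eulerGF t n                   ≡⟨ ⊛-identityʳ (eulerGF t) n ⟨
  (eulerGF t ⊛ one) n           ≡⟨ ℤ.*-identityˡ ((eulerGF t ⊛ one) n) ⟨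
  1ℤ * (eulerGF t ⊛ one) n      ≡⟨ ℤ.+-identityˡ _ ⟨
  Σ< 1 (λ k → coeff t 0 k * Aʰ (suc k) n t)
    ∎
theorem2 n (suc N) t = begin
  A (n +ℕ suc N) t                                            ≡⟨ cong (λ m → A m t) (ℕ.+-suc n N) ⟩
  A (suc n +ℕ N) t                                            ≡⟨ theorem2 (suc n) N t ⟩
  Σ< (suc N) (λ k → coeff t N k * Aʰ (suc k) (suc n) t)       ≡⟨ expansion-step t N n ⟩
  Σ< (suc (suc N)) (λ k → coeff t (suc N) k * Aʰ (suc k) n t) ∎
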